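{- Let $A$ be a finite set of actions equipped with an involution $\mathrm{dual}_A$. Let $\mathcal{L}$ and $\mathcal{M}$ be disjoint finite sets of locations, let $\mathbf{A}$ and $\mathbf{B}$ be $\mathcal{L}_A$-LTSs, let $\mathbf{C}$ be an $\mathcal{M}_A$-LTS, and let $\sigma$ be a partial injection from $\mathcal{L}$ to $\mathcal{M}$. If $\mathbf{A}\sim\mathbf{B}$, then $\mathbf{A}\,||_\sigma\,\mathbf{C}\sim\mathbf{B}\,||_\sigma\,\mathbf{C}$.
   Context: For a set $X$, $\mathbb{FM}(X)$ denotes the set of finite multisets over $X$; multiset union $\cup$ adds multiplicities. For a finite set of locations $\mathcal{L}$, $\mathcal{L}_A$ denotes $\mathbb{FM}(\mathcal{L}\times A)$. An $\mathcal{L}_A$-LTS (locative transition system) is a triple $\mathbf{A}=(S_\mathbf{A},\rightarrow_\mathbf{A},s_\mathbf{A})$ with a set of states $S_\mathbf{A}$, an initial state $s_\mathbf{A}\in S_\mathbf{A}$, and a transition relation $\rightarrow_\mathbf{A}\subseteq S_\mathbf{A}\times\mathcal{L}_A\times S_\mathbf{A}$; write $u\xrightarrow{\mathsf a}t$ for $(u,\mathsf a,t)\in\rightarrow_\mathbf{A}$. Given disjoint $\mathcal{L},\mathcal{M}$ and a partial injection $\sigma$ from $\mathcal{L}$ to $\mathcal{M}$ (a bijection $\mathrm{dom}(\sigma)\to\mathrm{rng}(\sigma)$ with $\mathrm{dom}(\sigma)\subseteq\mathcal{L}$, $\mathrm{rng}(\sigma)\subseteq\mathcal{M}$), a multiset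 over $(\mathcal{L}\cup\mathcal{M})\times A$ is $\sigma$-dual if it has the form $\{\!|(\ell_1,a_1),\dots,(\ell_n,a_n),(\sigma(\ell_1),b_1),\dots,(\sigma(\ell_n),b_n)|\!\}$ with $\ell_i\in\mathrm{dom}(\sigma)$ and $b_i=\mathrm{dual}_A(a_i)$ for all $i$; the set of these is $\bot_\sigma$. The $\sigma$-parallel composition $\mathbf{A}\,||_\sigma\,\mathbf{C}$ of an $\mathcal{L}_A$-LTS $\mathbf{A}$ and an $\mathcal{M}_A$-LTS $\mathbf{C}$ is the $\mathcal{N}_A$-LTS with $\mathcal{N}=(\mathcal{L}\cup\mathcal{M})\setminus(\mathrm{dom}(\sigma)\cup\mathrm{rng}(\sigma))$, states $S_\mathbf{A}\times S_\mathbf{C}$, initial state $(s_\mathbf{A},s_\mathbf{C})$, and transitions $\leadsto$ the union of: (i) $(u_\mathbf{A},u_\mathbf{C})\overset{\mathsf a}{\leadsto}(t_\mathbf{A},u_\mathbf{C})$ whenever $\mathsf a\in(\mathcal{L}\setminus\mathrm{dom}(\sigma))_A$ and $u_\mathbf{A}\xrightarrow{\mathsf a}t_\mathbf{A}$; (ii) $(u_\mathbf{A},u_\mathbf{C})\overset{\mathsf a}{\leadsto}(u_\mathbf{A},t_\mathbf{C})$ whenever $\mathsf a\in(\mathcal{M}\setminus\mathrm{rng}(\sigma))_A$ and $u_\mathbf{C}\xrightarrow{\mathsf a}t_\mathbf{C}$; (iii) $(u_\mathbf{A},u_\mathbf{C})\overset{\mathsf a}{\leadsto}(t_\mathbf{A},t_\mathbf{C})$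 whenever there are $\mathsf d\in\bot_\sigma$, $\mathsf b\in\mathcal{L}_A$, $\mathsf c\in\mathcal{M}_A$ with $u_\mathbf{A}\xrightarrow{\mathsf b}t_\mathbf{A}$, $u_\mathbf{C}\xrightarrow{\mathsf c}t_\mathbf{C}$ and $\mathsf a\cup\mathsf d=\mathsf b\cup\mathsf c$. A (strong) bisimulation between two LTSs $\mathbf{A},\mathbf{B}$ over the same label set is a relation $\mathcal{R}\subseteq S_\mathbf{A}\times S_\mathbf{B}$ with $s_\mathbf{A}\,\mathcal{R}\,s_\mathbf{B}$ such that whenever $u\,\mathcal{R}\,t$: if $u\xrightarrow{\mathsf a}v$ then $t\xrightarrow{\mathsf a}w$ for some $w$ with $v\,\mathcal{R}\,w$, and if $t\xrightarrow{\mathsf a}w$ then $u\xrightarrow{\mathsf a}v$ for some $v$ with $v\,\mathcal{R}\,w$. $\mathbf{A}\sim\mathbf{B}$ means such a bisimulation exists. -}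

module Defs where

open import Data.Nat using (ℕ; _+_; _<_)
open import Data.Bool using (Bool; true; false; if_then_else_; _∧_)
open import Data.Fin using (Fin; _≟_)
open import Data.Vec using (Vec; lookup; tabulate; replicate; zipWith)
open import Data.List using (List; foldr; map)
open import Data.List.Relation.Unary.All using (All)
open import Data.Maybe using (Maybe; just)
open import Data.Product using (Σ; ∃; _×_; _,_; proj₁; proj₂)
open import Data.Sum using (_⊎_; inj₁; inj₂)
open import Data.Empty using (⊥)
open import Relation.Nullary using (¬_)
open import Relation.Nullary.Decidable using (⌊_⌋)
open import Relation.Binary.PropositionalEquality using (_≡_)

-- Locations are drawn from an ambient finite set  Fin k ; a finite set of
-- locations is a predicate  Fin k → Set.
-- A finite multiset over (locations × actions) is a k × n table of
-- multiplicities (a canonical representation, so multiset equality is _≡_).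

LocSet : ℕ → Set₁
LocSet k = Fin k → Set

MSet : ℕ → ℕ → Set
MSet k n = Vec (Vec ℕ n) k

count : ∀ {k n} → MSet k n → Fin k → Fin n → ℕ
count m ℓ a = lookup (lookup m ℓ) a

∅ₘ : ∀ {k n} → MSet k n
∅ₘ = replicate _ (replicate _ 0)

⟦_⟧ₘ : ∀ {k n} → Fin k × Fin n → MSet k n
⟦ ℓ , a ⟧ₘ = tabulate λ ℓ' → tabulate λ a' →
  if ⌊ ℓ ≟ ℓ' ⌋ ∧ ⌊ a ≟ a' ⌋ then 1 else 0

_∪ₘ_ : ∀ {k n} → MSet k n → MSet k n → MSet k n
_∪ₘ_ = zipWith (zipWith _+_)

fromList : ∀ {k n} → List (Fin k × Fin n) → MSet k n
fromList = foldr (λ p acc → ⟦ p ⟧ₘ ∪ₘ acc) ∅ₘ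

Supp : ∀ {k n} → LocSet k → MSet k n → Set
Supp P m = ∀ ℓ a → 0 < count m ℓ a → P ℓ

Disjoint : ∀ {k} → LocSet k → LocSet k → Set
Disjoint L M = ∀ ℓ → L ℓ → M ℓ → ⊥

record LTS {k} (n : ℕ) (L : LocSet k) : Set₁ where
  field
    State : Set
    init  : State
    _⟶[_]_ : State → MSet k n → State → Set
    wf    : ∀ {u a t} → u ⟶[ a ] t → Supp L a

open LTS public

record PInj {k} (L M : LocSet k) : Set where
  field
    fun   : Fin k → Maybe (Fin k)
    dom⊆L : ∀ {ℓ ℓ'} → fun ℓ ≡ just ℓ' → L ℓ
    rng⊆M : ∀ {ℓ ℓ'} → fun ℓ ≡ just ℓ' → M ℓ'
    inj   : ∀ {ℓ₁ ℓ₂ ℓ'} → fun ℓ₁ ≡ just ℓ' → fun ℓ₂ ≡ just ℓ' → ℓ₁ ≡ ℓ₂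

open PInj public

module _ {k} {L M : LocSet k} (σ : PInj L M) where

  dom : LocSet k
  dom ℓ = ∃ λ ℓ' → fun σ ℓ ≡ just ℓ'

  rng : LocSet k
  rng ℓ' = ∃ λ ℓ → fun σ ℓ ≡ just ℓ'

  Nloc : LocSet k
  Nloc ℓ = (L ℓ ⊎ M ℓ) × ¬ dom ℓ × ¬ rng ℓ

  -- d ∈ ⊥_σ : d = {|(ℓ₁,a₁),…,(ℓₘ,aₘ),(σ ℓ₁, dual a₁),…,(σ ℓₘ, dual aₘ)|}
  -- (each entry (ℓ , ℓ' , a) records ℓ ∈ dom σ with σ ℓ = ℓ')
  σDual : ∀ {n} → (Fin n → Fin n) → MSet k n → Set
  σDual {n} dual d = Σ (List (Fin k × Fin k × Fin n)) λ ps →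
    All (λ { (ℓ , ℓ' , a) → fun σ ℓ ≡ just ℓ' }) ps ×
    (d ≡ (fromList (map (λ { (ℓ , ℓ' , a) → (ℓ , a) }) ps)
          ∪ₘ fromList (map (λ { (ℓ , ℓ' , a) → (ℓ' , dual a) }) ps)))

module _ {k n} (dual : Fin n → Fin n) {L M : LocSet k}
         (disj : Disjoint L M) (σ : PInj L M)
         (𝐀 : LTS n L) (𝐂 : LTS n M) where

  private
    SA = State 𝐀
    SC = State 𝐂
    _→A[_]_ = _⟶[_]_ 𝐀
    _→C[_]_ = _⟶[_]_ 𝐂

  data ParStep : SA × SC → MSet k n → SA × SC → Set where
    left  : ∀ {uA tA uC a} → Supp (λ ℓ → L ℓ × ¬ dom σ ℓ) a →
            uA →A[ a ] tA → ParStep (uA , uC) a (tA , uC)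
    right : ∀ {uA uC tC a} → Supp (λ ℓ → M ℓ × ¬ rng σ ℓ) a →
            uC →C[ a ] tC → ParStep (uA , uC) a (uA , tC)
    sync  : ∀ {uA tA uC tC a} → Supp (Nloc σ) a →
            (d b c : MSet k n) → σDual σ dual d →
            uA →A[ b ] tA → uC →C[ c ] tC →
            (a ∪ₘ d) ≡ (b ∪ₘ c) →
            ParStep (uA , uC) a (tA , tC)

  private
    wfPar : ∀ {u a t} → ParStep u a t → Supp (Nloc σ) a
    wfPar (left s _) ℓ x p =
      inj₁ (proj₁ (s ℓ x p)) , proj₂ (s ℓ x p) ,
      λ { (ℓ₀ , e) → disj ℓ (proj₁ (s ℓ x p)) (rng⊆M σ e) }
    wfPar (right s _) ℓ x p =
      inj₂ (proj₁ (s ℓ x p)) ,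
      (λ { (ℓ' , e) → disj ℓ (dom⊆L σ e) (proj₁ (s ℓ x p)) }) ,
      proj₂ (s ℓ x p)
    wfPar (sync s _ _ _ _ _ _ _) = s

  par : LTS n (Nloc σ)
  par = record
    { State = SA × SC
    ; init = (init 𝐀 , init 𝐂)
    ; _⟶[_]_ = ParStep
    ; wf = wfPar
    }

record Bisimulation {k n} {L : LocSet k} (𝐀 𝐁 : LTS n L) : Set₁ where
  field
    R     : State 𝐀 → State 𝐁 → Set
    R-init : R (init 𝐀) (init 𝐁)
    forth : ∀ {u t a v} → R u t → _⟶[_]_ 𝐀 u a v →
            ∃ λ w → _⟶[_]_ 𝐁 t a w × R v w
    back  : ∀ {u t a w} → R u t → _⟶[_]_ 𝐁 t a w →
            ∃ λ v → _⟶[_]_ 𝐀 u a v × R v w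

_∼_ : ∀ {k n} {L : LocSet k} → LTS n L → LTS n L → Set₁
𝐀 ∼ 𝐁 = Bisimulation 𝐀 𝐁

-- A bisimulation R between 𝐀 and 𝐁 lifts to 𝐀 ||_σ 𝐂 and 𝐁 ||_σ 𝐂 as R × (≡ on 𝐂):
-- every composite step involves at most one step of 𝐀, which R matches by a step
-- of 𝐁 with the same label, so the side conditions of the composite rule
-- (supports and the σ-dual decomposition) carry over unchanged.
module Submission where

open import Defs
open import Data.Nat using (ℕ)
open import Data.Fin using (Fin)
open import Data.Product using (∃; _×_; _,_)
open import Function using (flip)
open import Relation.Binary.PropositionalEquality using (_≡_; refl)

Simulates : ∀ {k n} {L : LocSet k} (𝐀 𝐁 : LTS n L) → (State 𝐀 → State 𝐁 → Set) → Set
Simulates 𝐀 𝐁 R = ∀ {u t a v} → R u t → _⟶[_]_ 𝐀 u a v →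
                  ∃ λ w → _⟶[_]_ 𝐁 t a w × R v w

_×≡_ : {A B : Set} → (A → B → Set) → (C : Set) → A × C → B × C → Set
(R ×≡ C) (u , c) (t , c′) = R u t × c ≡ c′

×≡-flip : {A B C : Set} {R : A → B → Set} {x : A × C} {y : B × C} →
          (R ×≡ C) x y → (flip R ×≡ C) y x
×≡-flip (r , refl) = r , refl

module _ {k n} (dual : Fin n → Fin n) {L M : LocSet k}
         (disj : Disjoint L M) (σ : PInj L M) (𝐂 : LTS n M) where

  par-simulates : {𝐀 𝐁 : LTS n L} {R : State 𝐀 → State 𝐁 → Set} →
                  Simulates 𝐀 𝐁 R →
                  Simulates (par dual disj σ 𝐀 𝐂) (par dual disj σ 𝐁 𝐂) (R ×≡ State 𝐂)
  par-simulates sim (r , refl) (left s stepA) with sim r stepA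
  ... | _ , stepB , r′ = _ , left s stepB , r′ , refl
  par-simulates sim (r , refl) (right s stepC) = _ , right s stepC , r , refl
  par-simulates sim (r , refl) (sync s d b c d-dual stepA stepC eq) with sim r stepA
  ... | _ , stepB , r′ = _ , sync s d b c d-dual stepB stepC eq , r′ , refl

proposition1 : ∀ {k n : ℕ} (dual : Fin n → Fin n) → (∀ a → dual (dual a) ≡ a) →
    (L M : LocSet k) (disj : Disjoint L M) (σ : PInj L M)
    (𝐀 𝐁 : LTS n L) (𝐂 : LTS n M) →
    𝐀 ∼ 𝐁 → par dual disj σ 𝐀 𝐂 ∼ par dual disj σ 𝐁 𝐂
proposition1 dual _ L M disj σ 𝐀 𝐁 𝐂 bis = record
  { R      = R ×≡ State 𝐂
  ; R-init = R-init , refl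
  ; forth  = par-simulates dual disj σ 𝐂 forth
  ; back   = par-back
  }
  where
  open Bisimulation bis
  par-back : Simulates (par dual disj σ 𝐁 𝐂) (par dual disj σ 𝐀 𝐂) (flip (R ×≡ State 𝐂))
  par-back r step with par-simulates dual disj σ 𝐂 back (×≡-flip {R = R} r) step
  ... | v , stepA , r′ = v , stepA , ×≡-flip {R = flip R} r′
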